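{- Let $(T,L)$ be a TAP instance where $T=(V,E)$ is a $k$-wide tree with root $r$, and let $L'\subseteq L$ be shadow-minimal. Then for each principal subtree $T_i=(V_i,E_i)$ of $T$, $L'$ contains at most $k$ cross-links with an endpoint in $V_i\setminus\{r\}$.
   Context: A TAP instance $(T,L)$: a tree $T=(V,E)$ and links $L\subseteq\binom{V}{2}$; for $\ell\in L$, $P_\ell$ is the edge set of the path in $T$ between its endpoints. $T$ is $k$-wide with root $r$ if every principal subtree (the subtree consisting of $r$, a child $u$ of $r$, and all descendants of $u$) has at most $k$ leaves. A cross-link is a link whose two endpoints are both different from $r$ and lie in different principal subtrees. The instance is assumed shadow-complete: for every $\ell\in L$ and any two distinct vertices $u,v$ on the path $P_\ell$, $\{u,v\}\in L$; such $\{u,v\}$ is a shadow of $\ell$. Two links $\ell_1,\ell_2$ are shadow-minimal if there is no shadow $s$ (different from the link itself) of one of them, say $\ell_1$, with $P_{\ell_1}\cup P_{\ell_2}=P_s\cup P_{\ell_2}$; a set of links is shadow-minimal if its links are pairwise shadow-minimal. -}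

module Defs where

open import Data.Nat using (ℕ; zero; suc; _≤_)
open import Data.Fin using (Fin)
open import Data.Product using (Σ; ∃; ∃-syntax; _×_; _,_)
open import Data.Sum using (_⊎_)
open import Data.List using (List; []; _∷_; [_]; length)
open import Data.List.Membership.Propositional using (_∈_)
open import Data.List.Relation.Unary.Unique.Propositional using (Unique)
open import Relation.Binary.PropositionalEquality using (_≡_; _≢_)
open import Relation.Nullary using (¬_)
open import Function.Bundles using (_⇔_)

-- The edges of T are {v , parent v} for v ≢ root.  The condition
-- 'reach' (every vertex reaches the root by iterating parent) makes
-- the resulting graph a tree (connected and acyclic).

iter : ∀ {n} → (Fin n → Fin n) → ℕ → Fin n → Fin n
iter p zero    v = v
iter p (suc m) v = p (iter p m v)

record RootedTree (n : ℕ) : Set where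
  field
    root     : Fin n
    parent   : Fin n → Fin n
    root-fix : parent root ≡ root
    reach    : ∀ v → ∃[ m ] iter parent m v ≡ root

module _ {n : ℕ} (T : RootedTree n) where
  open RootedTree T

  Adj : Fin n → Fin n → Set
  Adj x y = (x ≢ root × parent x ≡ y) ⊎ (y ≢ root × parent y ≡ x)

  Anc : Fin n → Fin n → Set
  Anc a v = ∃[ m ] iter parent m v ≡ a

  RootChild : Fin n → Set
  RootChild c = c ≢ root × parent c ≡ root

  -- v ∈ V_c ∖ {r}, where V_c is the vertex set of the principal
  -- subtree determined by the root-child c
  InSub : Fin n → Fin n → Set
  InSub c v = v ≢ root × Anc c v

  Leaf : Fin n → Set
  Leaf v = v ≢ root × (∀ x → x ≢ root → parent x ≢ v)

  KWide : ℕ → Set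
  KWide k = ∀ c → RootChild c → ∀ (vs : List (Fin n)) → Unique vs →
            (∀ v → v ∈ vs → InSub c v × Leaf v) → length vs ≤ k

  data Walk : Fin n → Fin n → List (Fin n) → Set where
    here : ∀ {u} → Walk u u [ u ]
    step : ∀ {x y w vs} → Adj x y → Walk y w vs → Walk x w (x ∷ vs)

  IsPath : Fin n → Fin n → List (Fin n) → Set
  IsPath u w vs = Walk u w vs × Unique vs

  data Consec (x y : Fin n) : List (Fin n) → Set where
    now   : ∀ {vs} → Consec x y (x ∷ y ∷ vs)
    later : ∀ {z vs} → Consec x y vs → Consec x y (z ∷ vs)

  PEdge : Fin n → Fin n → Fin n → Fin n → Set
  PEdge u w x y = ∃[ vs ] IsPath u w vs × (Consec x y vs ⊎ Consec y x vs)

  PVert : Fin n → Fin n → Fin n → Set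
  PVert u w x = ∃[ vs ] IsPath u w vs × x ∈ vs

  -- Links.  A set of links is a symmetric irreflexive relation on V
  -- (L u v means the unordered pair {u,v} is a link).

  LinkSet : Set₁
  LinkSet = Fin n → Fin n → Set

  IsLinkSet : LinkSet → Set
  IsLinkSet L = (∀ u v → L u v → L v u) × (∀ u → ¬ L u u)

  UEq : Fin n × Fin n → Fin n × Fin n → Set
  UEq (a , b) (x , y) = (a ≡ x × b ≡ y) ⊎ (a ≡ y × b ≡ x)

  ShadowOf : Fin n → Fin n → Fin n → Fin n → Set
  ShadowOf a b x y = PVert a b x × PVert a b y × x ≢ y

  ShadowComplete : LinkSet → Set
  ShadowComplete L = ∀ a b → L a b → ∀ x y → ShadowOf a b x y → L x y

  NoShadowReplace : Fin n → Fin n → Fin n → Fin n → Set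
  NoShadowReplace a b c d =
    ¬ (Σ (Fin n) λ x → Σ (Fin n) λ y →
         ShadowOf a b x y × ¬ UEq (x , y) (a , b) ×
         (∀ e f → (PEdge a b e f ⊎ PEdge c d e f) ⇔ (PEdge x y e f ⊎ PEdge c d e f)))

  ShadowMinimalPair : Fin n → Fin n → Fin n → Fin n → Set
  ShadowMinimalPair a b c d = NoShadowReplace a b c d × NoShadowReplace c d a b

  ShadowMinimal : LinkSet → Set
  ShadowMinimal L = ∀ a b c d → L a b → L c d → ¬ UEq (a , b) (c , d) →
                    ShadowMinimalPair a b c d

  TopChild : Fin n → Fin n → Set
  TopChild v c = RootChild c × InSub c v

  Cross : Fin n → Fin n → Set
  Cross u v = u ≢ root × v ≢ root ×
              (Σ (Fin n) λ c → Σ (Fin n) λ d → c ≢ d × TopChild u c × TopChild v d)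

-- Orient each cross-link {a , b} of the list so that a lies in the principal subtree T_c, and map
-- it to a deepest descendant of a, which is a leaf of T_c.  If two links {a₁ , b₁}, {a₂ , b₂} hit
-- the same leaf, then a₁ and a₂ both lie above it, say a₁ above a₂.  The shadow {r , b₁} of the
-- first link then covers, together with the second, exactly the edges the two links cover: the
-- edges between a₁ and r that it gives up already lie on the path from a₂ through r.  This
-- contradicts shadow-minimality, so the map is injective into the at most k leaves of T_c.

module Submission where

open import Defs
open import Data.Nat using (ℕ; zero; suc; _+_; _*_; _∸_; _≤_; s≤s; _≤?_)
open import Data.Nat.Properties
  using (≤-total; ≤-refl; m∸n+n≡m; m+[n∸m]≡n; m≤m*n; ≰⇒>; <⇒≤; n≮n; +-comm; module ≤-Reasoning)
open import Data.Fin using (Fin; toℕ; fromℕ; fromℕ<; _≟_)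
open import Data.Fin.Properties using (any?; toℕ-fromℕ; toℕ-fromℕ<)
open import Data.Product using (∃; ∃-syntax; _×_; _,_; proj₁; proj₂)
open import Data.Sum as Sum using (_⊎_; inj₁; inj₂)
open import Data.List using (List; []; _∷_; length; map; filter; allFin)
open import Data.List.Properties using (length-map)
open import Data.List.Extrema.Nat using (argmax; argmax-all; f[xs]≤f[argmax])
open import Data.List.Membership.Propositional using (_∈_)
open import Data.List.Membership.Propositional.Properties using (∈-allFin; ∈-filter⁺; ∈-map⁻)
import Data.List.Membership.DecPropositional as DecMembership
open import Data.List.Relation.Unary.Any using (here; there)
open import Data.List.Relation.Unary.All as All using (All; []; _∷_)
open import Data.List.Relation.Unary.All.Properties using (all-filter; ¬Any⇒All¬) renaming (map⁺ to All-map⁺)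
open import Data.List.Relation.Unary.AllPairs as AllPairs using (AllPairs; []; _∷_)
import Data.List.Relation.Unary.AllPairs.Properties as AllPairs
open import Data.List.Relation.Unary.Unique.Propositional using (Unique)
open import Data.Empty using (⊥-elim)
open import Function using (_∘_)
open import Function.Bundles using (_⇔_; mk⇔)
open import Relation.Nullary using (¬_; Dec; yes; no)
open import Relation.Nullary.Decidable using (map′)
open import Relation.Binary.PropositionalEquality
  using (_≡_; _≢_; refl; sym; trans; cong; subst; module ≡-Reasoning)

module _ {n : ℕ} (p : Fin n → Fin n) where

  iter-+ : ∀ s t v → iter p (s + t) v ≡ iter p s (iter p t v)
  iter-+ zero    t v = refl
  iter-+ (suc s) t v = cong p (iter-+ s t v)

  iter-sucʳ : ∀ m v → iter p (suc m) v ≡ iter p m (p v)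
  iter-sucʳ m v = trans (cong (λ k → iter p k v) (+-comm 1 m)) (iter-+ m 1 v)

  iter-fixed : ∀ {x} → p x ≡ x → ∀ m → iter p m x ≡ x
  iter-fixed px zero    = refl
  iter-fixed px (suc m) = trans (cong p (iter-fixed px m)) px

  iter-periodic : ∀ {x} m → iter p (suc m) x ≡ x → ∀ k → iter p (k * suc m) x ≡ x
  iter-periodic m h zero = refl
  iter-periodic {x} m h (suc k) =
    trans (iter-+ (suc m) (k * suc m) x) (trans (cong (iter p (suc m)) (iter-periodic m h k)) h)

module _ {n : ℕ} (T : RootedTree n) where
  open RootedTree T
  open DecMembership (_≟_ {n}) using (_∈?_)

  private variable
    a b e i j u v w x y z a₁ b₁ a₂ b₂ : Fin n
    vs ws : List (Fin n)
    m m′ s t : ℕ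

  iter-root : ∀ m → iter parent m root ≡ root
  iter-root = iter-fixed parent root-fix

  Anc-refl : Anc T v v
  Anc-refl = 0 , refl

  Anc-trans : Anc T a b → Anc T b v → Anc T a v
  Anc-trans {v = v} (s , p) (t , q) =
    s + t , trans (iter-+ parent s t v) (trans (cong (iter parent s) q) p)

  Anc-of-root : Anc T a root → a ≡ root
  Anc-of-root (m , p) = trans (sym p) (iter-root m)

  Anc-from-gap : s ≤ t → iter parent s v ≡ a → iter parent t v ≡ b → Anc T b a
  Anc-from-gap {s} {t} {v} {a} {b} s≤t p q = t ∸ s , (begin
    iter parent (t ∸ s) a                  ≡⟨ cong (iter parent (t ∸ s)) (sym p) ⟩
    iter parent (t ∸ s) (iter parent s v)  ≡⟨ sym (iter-+ parent (t ∸ s) s v) ⟩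
    iter parent (t ∸ s + s) v              ≡⟨ cong (λ k → iter parent k v) (m∸n+n≡m s≤t) ⟩
    iter parent t v                        ≡⟨ q ⟩
    b                                      ∎)
    where open ≡-Reasoning

  Anc-comparable : Anc T a v → Anc T b v → Anc T a b ⊎ Anc T b a
  Anc-comparable (s , p) (t , q) with ≤-total s t
  ... | inj₁ s≤t = inj₂ (Anc-from-gap s≤t p q)
  ... | inj₂ t≤s = inj₁ (Anc-from-gap t≤s q p)

  iter-beyond-root : iter parent m v ≡ root → m ≤ m′ → iter parent m′ v ≡ root
  iter-beyond-root h m≤m′ = Anc-of-root (Anc-from-gap m≤m′ h refl)

  -- A cycle through v would keep v's orbit away from the root.
  ¬Anc-parent : v ≢ root → ¬ Anc T v (parent v)
  ¬Anc-parent {v} v≢root (m , p) with reach v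
  ... | M , q = v≢root (begin
    v                          ≡⟨ sym (iter-periodic parent m (trans (iter-sucʳ parent m v) p) M) ⟩
    iter parent (M * suc m) v  ≡⟨ iter-beyond-root q (m≤m*n M (suc m)) ⟩
    root                       ∎)
    where open ≡-Reasoning

  Anc? : ∀ a v → Dec (Anc T a v)
  Anc? a v = map′ (λ (k , p) → toℕ k , p) bounded (any? λ k → iter parent (toℕ k) v ≟ a)
    where
    M = proj₁ (reach v)
    bounded : Anc T a v → ∃ λ (k : Fin (suc M)) → iter parent (toℕ k) v ≡ a
    bounded (m , p) with m ≤? M
    ... | yes m≤M = fromℕ< (s≤s m≤M) , trans (cong (λ k → iter parent k v) (toℕ-fromℕ< (s≤s m≤M))) p
    ... | no m≰M = fromℕ M , (begin
      iter parent (toℕ (fromℕ M)) v  ≡⟨ cong (λ k → iter parent k v) (toℕ-fromℕ M) ⟩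
      iter parent M v                ≡⟨ proj₂ (reach v) ⟩
      root                           ≡⟨ sym (iter-beyond-root (proj₂ (reach v)) (<⇒≤ (≰⇒> m≰M))) ⟩
      iter parent m v                ≡⟨ p ⟩
      a                              ∎)
      where open ≡-Reasoning

  -- With fuel m, height m v counts the steps from v up to the root, as long as m steps suffice.
  height : ℕ → Fin n → ℕ
  height zero    v = zero
  height (suc m) v with v ≟ root
  ... | yes _ = zero
  ... | no  _ = suc (height m (parent v))

  height-root : ∀ m → height m root ≡ zero
  height-root zero = refl
  height-root (suc m) with root ≟ root
  ... | yes _ = refl
  ... | no root≢root = ⊥-elim (root≢root refl)

  height-suc : v ≢ root → height (suc m) v ≡ suc (height m (parent v))
  height-suc {v} v≢root with v ≟ root
  ... | yes v≡root = ⊥-elim (v≢root v≡root)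
  ... | no  _ = refl

  height-+ : ∀ m k → iter parent m v ≡ root → height (m + k) v ≡ height m v
  height-+ zero k refl = height-root k
  height-+ {v} (suc m) k h with v ≟ root
  ... | yes _ = refl
  ... | no  _ = cong suc (height-+ m k (trans (sym (iter-sucʳ parent m v)) h))

  height-mono-fuel : m ≤ m′ → iter parent m v ≡ root → height m′ v ≡ height m v
  height-mono-fuel {m} {m′} {v} m≤m′ h =
    trans (cong (λ k → height k v) (sym (m+[n∸m]≡n m≤m′))) (height-+ m (m′ ∸ m) h)

  height-fuel : ∀ m m′ → iter parent m v ≡ root → iter parent m′ v ≡ root → height m v ≡ height m′ v
  height-fuel m m′ h h′ with ≤-total m m′
  ... | inj₁ m≤m′ = sym (height-mono-fuel m≤m′ h)
  ... | inj₂ m′≤m = height-mono-fuel m′≤m h′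

  depth : Fin n → ℕ
  depth v = height (proj₁ (reach v)) v

  depth-fuel : ∀ m → iter parent m v ≡ root → depth v ≡ height m v
  depth-fuel {v} m = height-fuel (proj₁ (reach v)) m (proj₂ (reach v))

  depth-parent : v ≢ root → depth v ≡ suc (depth (parent v))
  depth-parent {v} v≢root = via (reach v)
    where
    open ≡-Reasoning
    via : ∃[ m ] iter parent m v ≡ root → depth v ≡ suc (depth (parent v))
    via (zero  , v≡root) = ⊥-elim (v≢root v≡root)
    via (suc m , h) = begin
      depth v                    ≡⟨ depth-fuel (suc m) h ⟩
      height (suc m) v           ≡⟨ height-suc v≢root ⟩
      suc (height m (parent v))  ≡⟨ cong suc (sym (depth-fuel m h′)) ⟩
      suc (depth (parent v))     ∎
      where
      h′ : iter parent m (parent v) ≡ root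
      h′ = trans (sym (iter-sucʳ parent m v)) h

  descendants : Fin n → List (Fin n)
  descendants a = filter (Anc? a) (allFin n)

  deepest : Fin n → Fin n
  deepest a = argmax depth a (descendants a)

  Anc-deepest : Anc T a (deepest a)
  Anc-deepest {a} = argmax-all depth Anc-refl (all-filter (Anc? a) (allFin n))

  depth≤depth-deepest : Anc T a v → depth v ≤ depth (deepest a)
  depth≤depth-deepest {a} {v} av =
    All.lookup (f[xs]≤f[argmax] a (descendants a)) (∈-filter⁺ (Anc? a) (∈-allFin v) av)

  deepest-Leaf : a ≢ root → Leaf T (deepest a)
  deepest-Leaf {a} a≢root = deepest≢root , childless
    where
    deepest≢root : deepest a ≢ root
    deepest≢root eq = a≢root (Anc-of-root (subst (Anc T a) eq Anc-deepest))
    childless : ∀ x → x ≢ root → parent x ≢ deepest a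
    childless x x≢root eq = n≮n (depth x) (begin-strict
      depth x                       ≤⟨ depth≤depth-deepest (Anc-trans Anc-deepest (1 , eq)) ⟩
      depth (deepest a)             ≡⟨ cong depth (sym eq) ⟩
      depth (parent x)              <⟨ s≤s ≤-refl ⟩
      suc (depth (parent x))        ≡⟨ sym (depth-parent x≢root) ⟩
      depth x                       ∎)
      where open ≤-Reasoning

  Adj-sym : Adj T x y → Adj T y x
  Adj-sym (inj₁ xy) = inj₂ xy
  Adj-sym (inj₂ yx) = inj₁ yx

  walk-++ : Walk T x y vs → Walk T y z ws → ∃ (Walk T x z)
  walk-++ here        q = _ , q
  walk-++ (step xy p) q = _ , step xy (proj₂ (walk-++ p q))

  walk-reverse : Walk T x y vs → ∃ (Walk T y x)
  walk-reverse here        = _ , here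
  walk-reverse (step xy p) = walk-++ (proj₂ (walk-reverse p)) (step (Adj-sym xy) here)

  walk-to-root : ∀ v m → iter parent m v ≡ root → ∃ (Walk T v root)
  walk-to-root v zero    refl = _ , here
  walk-to-root v (suc m) h with v ≟ root
  ... | yes refl  = _ , here
  ... | no v≢root = _ , step (inj₁ (v≢root , refl))
                           (proj₂ (walk-to-root (parent v) m (trans (sym (iter-sucʳ parent m v)) h)))

  walk-suffix : Walk T x w vs → z ∈ vs → Unique vs → ∃ (IsPath T z w)
  walk-suffix here        (here refl) un       = _ , here , un
  walk-suffix (step xy p) (here refl) un       = _ , step xy p , un
  walk-suffix (step _ p)  (there z∈)  (_ ∷ un) = walk-suffix p z∈ un

  walk⇒path : Walk T x w vs → ∃ (IsPath T x w)
  walk⇒path here = _ , here , [] ∷ []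
  walk⇒path {x} (step xy p) with walk⇒path p
  ... | ps , q , un with x ∈? ps
  ...   | yes x∈ps = walk-suffix q x∈ps un
  ...   | no  x∉ps = _ , step xy q , ¬Any⇒All¬ ps x∉ps ∷ un

  path : ∀ u w → ∃ (IsPath T u w)
  path u w =
    let _ , u⇝root = walk-to-root u (proj₁ (reach u)) (proj₂ (reach u))
        _ , w⇝root = walk-to-root w (proj₁ (reach w)) (proj₂ (reach w))
    in walk⇒path (proj₂ (walk-++ u⇝root (proj₂ (walk-reverse w⇝root))))

  walk-head : Walk T x w (z ∷ vs) → x ≡ z
  walk-head here       = refl
  walk-head (step _ _) = refl

  walk-end-∈ : Walk T x w vs → w ∈ vs
  walk-end-∈ here       = here refl
  walk-end-∈ (step _ p) = there (walk-end-∈ p)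

  Consec-∈ʳ : Consec T x y vs → y ∈ vs
  Consec-∈ʳ now       = there (here refl)
  Consec-∈ʳ (later c) = there (Consec-∈ʳ c)

  Consec-head : Walk T y w vs → Consec T x y (x ∷ vs)
  Consec-head here       = now
  Consec-head (step _ _) = now

  Consec-Adj : Walk T u w vs → Consec T x y vs → Adj T x y
  Consec-Adj (step xy here)       now       = xy
  Consec-Adj (step xy (step _ _)) now       = xy
  Consec-Adj (step _ p)           (later c) = Consec-Adj p c

  Adj-leaving : Adj T x y → Anc T e x → ¬ Anc T e y → x ≡ e × y ≡ parent e
  Adj-leaving (inj₁ (_ , refl)) (zero , refl) _ = refl , refl
  Adj-leaving {x} (inj₁ (_ , refl)) (suc m , p) ¬ey =
    ⊥-elim (¬ey (m , trans (sym (iter-sucʳ parent m x)) p))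
  Adj-leaving {y = y} (inj₂ (_ , refl)) (m , p) ¬ey =
    ⊥-elim (¬ey (suc m , trans (iter-sucʳ parent m y) p))

  walk-exits : Walk T u w vs → Anc T e u → ¬ Anc T e w → Consec T e (parent e) vs
  walk-exits here eu ¬ew = ⊥-elim (¬ew eu)
  walk-exits {e = e} (step {y = y} xy p) eu ¬ew with Anc? e y
  ... | yes ey = later (walk-exits p ey ¬ew)
  ... | no ¬ey with Adj-leaving xy eu ¬ey
  ...   | refl , refl = Consec-head p

  walk-enters : Walk T u w vs → ¬ Anc T e u → Anc T e w → Consec T (parent e) e vs
  walk-enters here ¬eu ew = ⊥-elim (¬eu ew)
  walk-enters {e = e} (step {y = y} xy p) ¬eu ew with Anc? e y
  ... | no ¬ey = later (walk-enters p ¬ey ew)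
  ... | yes ey with Adj-leaving (Adj-sym xy) ey ¬eu
  ...   | refl , refl = Consec-head p

  -- A simple path crosses {e , parent e} at most once: crossing it again would revisit e or parent e.
  path-descends : Walk T u w vs → Unique vs → e ≢ root → Consec T e (parent e) vs →
                  Anc T e u × ¬ Anc T e w
  path-descends {e = e} (step _ p) (e∉ ∷ _) e≢root now = Anc-refl , λ ew →
    let re-entry = walk-enters p (¬Anc-parent e≢root ∘ subst (Anc T e) (walk-head p)) ew
    in All.lookup e∉ (Consec-∈ʳ re-entry) refl
  path-descends {u = u} {e = e} (step xy p) (u∉ ∷ un) e≢root (later c) with path-descends p un e≢root c
  ... | ey , ¬ew with Anc? e u
  ...   | yes eu = eu , ¬ew
  ...   | no ¬eu = ⊥-elim (All.lookup u∉ (Consec-∈ʳ c) (proj₂ (Adj-leaving (Adj-sym xy) ey ¬eu)))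

  path-ascends : Walk T u w vs → Unique vs → e ≢ root → Consec T (parent e) e vs →
                 ¬ Anc T e u × Anc T e w
  path-ascends {w = w} {e = e} (step _ p) (pe∉ ∷ _) e≢root now with Anc? e w
  ... | yes ew = ¬Anc-parent e≢root , ew
  ... | no ¬ew =
    let re-exit = walk-exits p (subst (Anc T e) (sym (walk-head p)) Anc-refl) ¬ew
    in ⊥-elim (All.lookup pe∉ (Consec-∈ʳ re-exit) refl)
  path-ascends (step xy p) (u∉ ∷ un) e≢root (later c) with path-ascends p un e≢root c
  ... | ¬ey , ew = (λ eu → All.lookup u∉ (Consec-∈ʳ c) (proj₁ (Adj-leaving xy eu ¬ey))) , ew

  UEq-swap : UEq T (x , y) (y , x)
  UEq-swap = inj₂ (refl , refl)

  UEq-sym : UEq T (a , b) (x , y) → UEq T (x , y) (a , b)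
  UEq-sym (inj₁ (refl , refl)) = inj₁ (refl , refl)
  UEq-sym (inj₂ (refl , refl)) = inj₂ (refl , refl)

  UEq-trans : UEq T (a , b) (x , y) → UEq T (x , y) (u , v) → UEq T (a , b) (u , v)
  UEq-trans (inj₁ (refl , refl)) q                    = q
  UEq-trans (inj₂ (refl , refl)) (inj₁ (refl , refl)) = inj₂ (refl , refl)
  UEq-trans (inj₂ (refl , refl)) (inj₂ (refl , refl)) = inj₁ (refl , refl)

  -- A vertex e ≢ root stands for the tree edge {e , parent e}.
  Separates : Fin n → Fin n → Fin n → Set
  Separates e u w = (Anc T e u × ¬ Anc T e w) ⊎ (¬ Anc T e u × Anc T e w)

  SeparatingEdge : Fin n → Fin n → Fin n → Fin n → Set
  SeparatingEdge u w x y = ∃[ e ] e ≢ root × Separates e u w × UEq T (x , y) (e , parent e)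

  Consec⇒SeparatingEdge : Walk T u w vs → Unique vs → Consec T x y vs → SeparatingEdge u w x y
  Consec⇒SeparatingEdge p un c with Consec-Adj p c
  ... | inj₁ (x≢root , refl) = _ , x≢root , inj₁ (path-descends p un x≢root c) , inj₁ (refl , refl)
  ... | inj₂ (y≢root , refl) = _ , y≢root , inj₂ (path-ascends p un y≢root c) , inj₂ (refl , refl)

  PEdge⇒SeparatingEdge : PEdge T u w x y → SeparatingEdge u w x y
  PEdge⇒SeparatingEdge (_ , (p , un) , inj₁ c) = Consec⇒SeparatingEdge p un c
  PEdge⇒SeparatingEdge (_ , (p , un) , inj₂ c) with Consec⇒SeparatingEdge p un c
  ... | e , e≢root , sep , yx≈ = e , e≢root , sep , UEq-trans UEq-swap yx≈

  Separates⇒PEdge : Separates e u w → PEdge T u w e (parent e)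
  Separates⇒PEdge {u = u} {w = w} (inj₁ (eu , ¬ew)) =
    let vs , p , un = path u w in vs , (p , un) , inj₁ (walk-exits p eu ¬ew)
  Separates⇒PEdge {u = u} {w = w} (inj₂ (¬eu , ew)) =
    let vs , p , un = path u w in vs , (p , un) , inj₂ (walk-enters p ¬eu ew)

  PEdge-resp-UEq : UEq T (x , y) (a , b) → PEdge T u w a b → PEdge T u w x y
  PEdge-resp-UEq (inj₁ (refl , refl)) q                = q
  PEdge-resp-UEq (inj₂ (refl , refl)) (vs , p , inj₁ c) = vs , p , inj₂ c
  PEdge-resp-UEq (inj₂ (refl , refl)) (vs , p , inj₂ c) = vs , p , inj₁ c

  SeparatingEdge⇒PEdge : SeparatingEdge u w x y → PEdge T u w x y
  SeparatingEdge⇒PEdge (_ , _ , sep , xy≈) = PEdge-resp-UEq xy≈ (Separates⇒PEdge sep)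

  PEdge-cover : ∀ {u′ w′ u″ w″} →
                (∀ e → e ≢ root → Separates e u w → Separates e u′ w′ ⊎ Separates e u″ w″) →
                PEdge T u w x y → PEdge T u′ w′ x y ⊎ PEdge T u″ w″ x y
  PEdge-cover cover q with PEdge⇒SeparatingEdge q
  ... | e , e≢root , sep , xy≈ =
    Sum.map (λ sep′ → SeparatingEdge⇒PEdge (e , e≢root , sep′ , xy≈))
            (λ sep″ → SeparatingEdge⇒PEdge (e , e≢root , sep″ , xy≈))
            (cover e e≢root sep)

  Anc-of-RootChild : RootChild T i → Anc T a i → a ≡ i ⊎ a ≡ root
  Anc-of-RootChild _ (zero , i≡a) = inj₁ (sym i≡a)
  Anc-of-RootChild {i} (_ , pi≡root) (suc m , p) = inj₂ (begin
    _                        ≡⟨ sym p ⟩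
    iter parent (suc m) i    ≡⟨ iter-sucʳ parent m i ⟩
    iter parent m (parent i) ≡⟨ cong (iter parent m) pi≡root ⟩
    iter parent m root       ≡⟨ iter-root m ⟩
    root                     ∎)
    where open ≡-Reasoning

  RootChild-Anc-RootChild : RootChild T i → RootChild T j → Anc T i j → i ≡ j
  RootChild-Anc-RootChild (i≢root , _) rj ij with Anc-of-RootChild rj ij
  ... | inj₁ i≡j    = i≡j
  ... | inj₂ i≡root = ⊥-elim (i≢root i≡root)

  RootChild-unique : RootChild T i → RootChild T j → Anc T i x → Anc T j x → i ≡ j
  RootChild-unique ri rj ix jx with Anc-comparable ix jx
  ... | inj₁ ij = RootChild-Anc-RootChild ri rj ij
  ... | inj₂ ji = sym (RootChild-Anc-RootChild rj ri ji)

  RootChild-above : RootChild T i → e ≢ root → Anc T i x → Anc T e x → Anc T i e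
  RootChild-above ri e≢root ix ex with Anc-comparable ix ex
  ... | inj₁ ie = ie
  ... | inj₂ ei with Anc-of-RootChild ri ei
  ...   | inj₁ refl   = Anc-refl
  ...   | inj₂ e≡root = ⊥-elim (e≢root e≡root)

  Cross-sym : Cross T u v → Cross T v u
  Cross-sym (u≢root , v≢root , i , j , i≢j , ui , vj) = v≢root , u≢root , j , i , i≢j ∘ sym , vj , ui

  Cross-disjoint : Cross T u v → e ≢ root → Anc T e u → ¬ Anc T e v
  Cross-disjoint (_ , _ , _ , _ , i≢j , (ri , _ , iu) , (rj , _ , jv)) e≢root eu ev =
    i≢j (RootChild-unique ri rj (Anc-trans (RootChild-above ri e≢root iu eu) ev) jv)

  PVert-end : PVert T u w w
  PVert-end {u} {w} = let vs , p = path u w in vs , p , walk-end-∈ (proj₁ p)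

  root-on-Cross-path : Cross T u v → PVert T u v root
  root-on-Cross-path {u} {v} uv@(_ , _ , _ , _ , _ , ((i≢root , pi≡root) , _ , iu) , _) =
    let vs , p , un = path u v
        exit = walk-exits p iu (Cross-disjoint uv i≢root iu)
    in vs , (p , un) , subst (_∈ vs) pi≡root (Consec-∈ʳ exit)

  nested-Cross-shadow : Cross T a₁ b₁ → Cross T a₂ b₂ → Anc T a₁ a₂ → ∀ x y →
    (PEdge T a₁ b₁ x y ⊎ PEdge T a₂ b₂ x y) ⇔ (PEdge T root b₁ x y ⊎ PEdge T a₂ b₂ x y)
  nested-Cross-shadow {a₁} {b₁} {a₂} {b₂} a₁b₁ a₂b₂ a₁a₂ x y =
    mk⇔ Sum.[ PEdge-cover to , inj₂ ] Sum.[ PEdge-cover from , inj₂ ]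
    where
    to : ∀ e → e ≢ root → Separates e a₁ b₁ → Separates e root b₁ ⊎ Separates e a₂ b₂
    to e e≢root (inj₁ (ea₁ , _)) =
      let ea₂ = Anc-trans ea₁ a₁a₂ in inj₂ (inj₁ (ea₂ , Cross-disjoint a₂b₂ e≢root ea₂))
    to e e≢root (inj₂ (_ , eb₁)) = inj₁ (inj₂ (e≢root ∘ Anc-of-root , eb₁))
    from : ∀ e → e ≢ root → Separates e root b₁ → Separates e a₁ b₁ ⊎ Separates e a₂ b₂
    from e e≢root (inj₁ (er , _))   = ⊥-elim (e≢root (Anc-of-root er))
    from e e≢root (inj₂ (_ , eb₁)) = inj₁ (inj₂ ((λ ea₁ → Cross-disjoint a₁b₁ e≢root ea₁ eb₁) , eb₁))

  ShadowMinimal⇒¬nested : ∀ {L′ : LinkSet T} → ShadowMinimal T L′ →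
    L′ a₁ b₁ → L′ a₂ b₂ → Cross T a₁ b₁ → Cross T a₂ b₂ → ¬ UEq T (a₁ , b₁) (a₂ , b₂) →
    ¬ Anc T a₁ a₂
  ShadowMinimal⇒¬nested {a₁} {b₁} sm l₁ l₂ a₁b₁@(a₁≢root , b₁≢root , _) a₂b₂ ≉ a₁a₂ =
    proj₁ (sm _ _ _ _ l₁ l₂ ≉) (root , b₁ , shadow , ≉shadow , nested-Cross-shadow a₁b₁ a₂b₂ a₁a₂)
    where
    shadow : ShadowOf T a₁ b₁ root b₁
    shadow = root-on-Cross-path a₁b₁ , PVert-end , b₁≢root ∘ sym
    ≉shadow : ¬ UEq T (root , b₁) (a₁ , b₁)
    ≉shadow (inj₁ (root≡a₁ , _)) = a₁≢root (sym root≡a₁)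
    ≉shadow (inj₂ (root≡b₁ , _)) = b₁≢root (sym root≡b₁)

  orient : Fin n → Fin n × Fin n → Fin n × Fin n
  orient c (u , v) with Anc? c u
  ... | yes _ = u , v
  ... | no  _ = v , u

  orient-UEq : ∀ c p → UEq T (orient c p) p
  orient-UEq c (u , v) with Anc? c u
  ... | yes _ = inj₁ (refl , refl)
  ... | no  _ = UEq-swap

  leaf-of : Fin n × Fin n → Fin n
  leaf-of (a , _) = deepest a

module _ {n : ℕ} (T : RootedTree n) (L′ : LinkSet T) (c : Fin n) where

  private variable
    p q : Fin n × Fin n

  OrientedCrossLink : Fin n × Fin n → Set
  OrientedCrossLink (a , b) = L′ a b × Cross T a b × InSub T c a

  orient-OrientedCrossLink : IsLinkSet T L′ → ∀ u v →
    L′ u v × Cross T u v × (InSub T c u ⊎ InSub T c v) → OrientedCrossLink (orient T c (u , v))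
  orient-OrientedCrossLink _ u v (uv , u×v , _) with Anc? T c u
  orient-OrientedCrossLink _         u v (uv , u×v , _)               | yes cu = uv , u×v , proj₁ u×v , cu
  orient-OrientedCrossLink (L′-sym , _) u v (uv , u×v , inj₂ below)     | no  _  = L′-sym u v uv , Cross-sym T u×v , below
  orient-OrientedCrossLink _         u v (_  , _   , inj₁ (_ , cu))   | no ¬cu = ⊥-elim (¬cu cu)

  leaf-of-InSub-Leaf : OrientedCrossLink p → InSub T c (leaf-of T p) × Leaf T (leaf-of T p)
  leaf-of-InSub-Leaf (_ , _ , a≢root , ca) =
    let leaf = deepest-Leaf T a≢root in (proj₁ leaf , Anc-trans T ca (Anc-deepest T)) , leaf

  leaf-of-injective : ShadowMinimal T L′ → OrientedCrossLink p → OrientedCrossLink q →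
                      ¬ UEq T p q → leaf-of T p ≢ leaf-of T q
  leaf-of-injective {_ , _} {a₂ , _} sm (l₁ , x₁ , _) (l₂ , x₂ , _) ≉ same
    with Anc-comparable T (Anc-deepest T) (subst (Anc T a₂) (sym same) (Anc-deepest T))
  ... | inj₁ a₁a₂ = ShadowMinimal⇒¬nested T sm l₁ l₂ x₁ x₂ ≉ a₁a₂
  ... | inj₂ a₂a₁ = ShadowMinimal⇒¬nested T sm l₂ l₁ x₂ x₁ (≉ ∘ UEq-sym T) a₂a₁

AllPairs-map-All : ∀ {A : Set} {P : A → Set} {R S : A → A → Set} {xs : List A} →
                   (∀ {x y} → P x → P y → R x y → S x y) → All P xs → AllPairs R xs → AllPairs S xs
AllPairs-map-All f []         []         = []
AllPairs-map-All f (px ∷ pxs) (rx ∷ rxs) =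
  All.zipWith (λ (py , r) → f px py r) (pxs , rx) ∷ AllPairs-map-All f pxs rxs

lemma1 : ∀ {n : ℕ} (T : RootedTree n) (k : ℕ) (L L' : LinkSet T) →
    KWide T k → IsLinkSet T L → ShadowComplete T L →
    IsLinkSet T L' → (∀ u v → L' u v → L u v) → ShadowMinimal T L' →
    ∀ c → RootChild T c →
    ∀ (xs : List (Fin n × Fin n)) → AllPairs (λ p q → ¬ UEq T p q) xs →
    (∀ u v → (u , v) ∈ xs → L' u v × Cross T u v × (InSub T c u ⊎ InSub T c v)) →
    length xs ≤ k
lemma1 T k _ L′ wide _ _ isL′ _ sm c rc xs distinct links = begin
  length xs        ≡⟨ sym (length-map (orient T c) xs) ⟩
  length oriented  ≡⟨ sym (length-map (leaf-of T) oriented) ⟩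
  length leaves    ≤⟨ wide c rc leaves leaves-unique leaves-in-subtree ⟩
  k                ∎
  where
  open ≤-Reasoning
  oriented = map (orient T c) xs
  leaves   = map (leaf-of T) oriented

  oriented-ok : All (OrientedCrossLink T L′ c) oriented
  oriented-ok = All-map⁺ (All.tabulate λ p∈ → orient-OrientedCrossLink T L′ c isL′ _ _ (links _ _ p∈))

  oriented-distinct : AllPairs (λ p q → ¬ UEq T p q) oriented
  oriented-distinct = AllPairs.map⁺ (AllPairs.map (λ {p} {q} ≉ ≈ →
    ≉ (UEq-trans T (UEq-sym T (orient-UEq T c p)) (UEq-trans T ≈ (orient-UEq T c q)))) distinct)

  leaves-unique : Unique leaves
  leaves-unique = AllPairs.map⁺ (AllPairs-map-All (leaf-of-injective T L′ c sm) oriented-ok oriented-distinct)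

  leaves-in-subtree : ∀ v → v ∈ leaves → InSub T c v × Leaf T v
  leaves-in-subtree v v∈ with ∈-map⁻ (leaf-of T) v∈
  ... | p , p∈ , refl = leaf-of-InSub-Leaf T L′ c (All.lookup oriented-ok p∈)
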